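{- $M_2$ is a well-defined $\mathcal{L}_1$-structure; that is, $\varepsilon\in\mathfrak L$, and for all $n\in\mathbb N$ and $l,l_1,l_2\in\mathfrak L$ we have $(n)\frown l\in\mathfrak L$ and $l_1\frown l_2\in\mathfrak L$.
   Context: Sequences: for a set $\mathcal X$ and ordinal $\alpha$, $\mathcal X^\alpha$ is the set of functions $\alpha\to\mathcal X$; $\mathbb N^*$ is the set of finite sequences of naturals; $\varepsilon$ is the empty sequence and $(n)$ a one-element sequence. For $a\in\mathcal X^\alpha$, $b\in\mathcal X^\beta$, $a\frown b\in\mathcal X^{\alpha+\beta}$ is given by $(a\frown b)_\gamma=a_\gamma$ for $\gamma<\alpha$ and $(a\frown b)_{\alpha+\delta}=b_\delta$. For $\alpha>0$ and $\mathfrak a\in(\mathcal X^\alpha)^\beta$, $\lfloor\mathfrak a\rfloor\in\mathcal X^{\alpha\cdot\beta}$ is given by $\lfloor\mathfrak a\rfloor_{\alpha\cdot\delta+\mu}=(\mathfrak a_\delta)_\mu$ for $\mu<\alpha$. For $k\in\mathbb N$, $N_k=(i)_{k\le i<\omega}$, and $\mathcal N=\{w\frown N_k: w\in\mathbb N^*,k\in\mathbb N\}$. The language $\mathcal L_1$ has sorts $\mathsf i$, $\mathsf{list}$ and symbols $\mathit{nil}:\mathsf{list}$, $\mathit{cons}:\mathsf i\times\mathsf{list}\to\mathsf{list}$, infix $\frown:\mathsf{list}\times\mathsf{list}\to\mathsf{list}$. The structure $M_2$ interprets $\mathsf i$ as $\mathbb N$, $\mathsf{list}$ as $\mathfrak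 L=\{\lfloor\mathfrak l\rfloor\frown w: w\in\mathbb N^*, \mathfrak l\in\mathcal N^\beta,\beta<\omega^2\}$, $\mathit{nil}$ as $\varepsilon$, $\mathit{cons}(n,l)$ as $(n)\frown l$, and $\frown$ as concatenation of sequences. -}

module Defs where

open import Data.Nat using (ℕ; zero; suc; _+_; _∸_; _<ᵇ_; _≡ᵇ_)
open import Data.Bool using (Bool; true; false; if_then_else_; T; _∧_; _∨_)
open import Data.List using (List; []; _∷_; length)
open import Data.Product using (Σ; _×_; _,_)
open import Relation.Binary.PropositionalEquality using (_≡_)

-- Ordinals below ω³, in Cantor normal form:  ⟨ a , b , c ⟩ = ω²·a + ω·b + c.
-- (Every sequence occurring in the statement has length < ω³.)

record Ord : Set where
  constructor ⟨_,_,_⟩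
  field
    hi mid lo : ℕ

_<ᵒᵇ_ : Ord → Ord → Bool
⟨ a , b , c ⟩ <ᵒᵇ ⟨ a' , b' , c' ⟩ =
  (a <ᵇ a') ∨ ((a ≡ᵇ a') ∧ ((b <ᵇ b') ∨ ((b ≡ᵇ b') ∧ (c <ᵇ c'))))

_<ₒ_ : Ord → Ord → Set
x <ₒ y = T (x <ᵒᵇ y)

_+ₒ_ : Ord → Ord → Ord
⟨ a , b , c ⟩ +ₒ ⟨ suc a' , b' , c' ⟩ = ⟨ a + suc a' , b' , c' ⟩
⟨ a , b , c ⟩ +ₒ ⟨ zero , suc b' , c' ⟩ = ⟨ a , b + suc b' , c' ⟩
⟨ a , b , c ⟩ +ₒ ⟨ zero , zero , c' ⟩ = ⟨ a , b , c + c' ⟩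

-- left subtraction: for α ≤ γ, (γ ∸ₒ α) is the unique δ with α + δ = γ
_∸ₒ_ : Ord → Ord → Ord
⟨ a' , b' , c' ⟩ ∸ₒ ⟨ a , b , c ⟩ =
  if a <ᵇ a' then ⟨ a' ∸ a , b' , c' ⟩
  else if b <ᵇ b' then ⟨ 0 , b' ∸ b , c' ⟩
  else ⟨ 0 , 0 , c' ∸ c ⟩

-- Transfinite sequences of naturals of length < ω³:
-- a length α and the values at positions γ < α (values at γ ≥ α are ignored).

record Seq : Set where
  constructor mkSeq
  field
    len : Ord
    at  : Ord → ℕ
open Seq public

_≈_ : Seq → Seq → Set
s ≈ t = (len s ≡ len t) × (∀ γ → γ <ₒ len s → at s γ ≡ at t γ)

_⌢_ : Seq → Seq → Seq
s ⌢ t = mkSeq (len s +ₒ len t)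
              (λ γ → if γ <ᵒᵇ len s then at s γ else at t (γ ∸ₒ len s))

εₛ : Seq
εₛ = mkSeq ⟨ 0 , 0 , 0 ⟩ (λ _ → 0)

⟦_⟧ : ℕ → Seq
⟦ n ⟧ = mkSeq ⟨ 0 , 0 , 1 ⟩ (λ _ → n)

nth : List ℕ → ℕ → ℕ
nth []      _       = 0
nth (x ∷ _) zero    = x
nth (_ ∷ w) (suc i) = nth w i

fin : List ℕ → Seq
fin w = mkSeq ⟨ 0 , 0 , length w ⟩ (λ γ → nth w (Ord.lo γ))

Nseq : ℕ → Seq
Nseq k = mkSeq ⟨ 0 , 1 , 0 ⟩ (λ γ → k + Ord.lo γ)

In𝒩 : Seq → Set
In𝒩 s = Σ (List ℕ) λ w → Σ ℕ λ k → s ≈ (fin w ⌢ Nseq k)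

-- ⌊𝔩⌋ for 𝔩 ∈ (ℕ^ω)^β with β = ω·m + k < ω² :
-- a sequence of length ω·β = ω²·m + ω·k with ⌊𝔩⌋_{ω·δ+μ} = (𝔩_δ)_μ (μ < ω),
-- where for δ = ω·p + q one has ω·δ + μ = ω²·p + ω·q + μ.
floorω : ℕ → ℕ → (Ord → Seq) → Seq
floorω m k 𝔩 = mkSeq ⟨ m , k , 0 ⟩
  (λ γ → at (𝔩 ⟨ 0 , Ord.hi γ , Ord.mid γ ⟩) ⟨ 0 , 0 , Ord.lo γ ⟩)

-- membership in 𝔏 = { ⌊𝔩⌋ ⌢ w : w ∈ ℕ*, 𝔩 ∈ 𝒩^β, β < ω² }
-- (β < ω² is written β = ω·m + k; 𝔩 is a family indexed by δ < β)
In𝔏 : Seq → Set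
In𝔏 s = Σ ℕ λ m → Σ ℕ λ k → Σ (Ord → Seq) λ 𝔩 → Σ (List ℕ) λ w →
          (∀ δ → δ <ₒ ⟨ 0 , m , k ⟩ → In𝒩 (𝔩 δ)) × (s ≈ (floorω m k 𝔩 ⌢ fin w))

-- Write l ∈ 𝔏 as ⌊𝔩⌋ ⌢ w. For l₁ = ⌊𝔩₁⌋ ⌢ w₁ and l₂ = ⌊𝔩₂⌋ ⌢ w₂ with 𝔩₂ of
-- length β₂: if β₂ = 0 then l₁ ⌢ l₂ = ⌊𝔩₁⌋ ⌢ w₁w₂. Otherwise the finite word w₁
-- is absorbed into the first block of 𝔩₂, since w₁ ⌢ (v ⌢ N_k) = w₁v ⌢ N_k ∈ 𝒩,
-- and ⌊𝔩₁⌋ ⌢ ⌊𝔩₂'⌋ = ⌊𝔩₁ ⌢ 𝔩₂'⌋ where 𝔩₁ ⌢ 𝔩₂' has length β₁ + β₂ < ω².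
-- Finite words, in particular ε and (n), lie in 𝔏 with β = 0.
module Submission where

open import Defs
open import Data.Nat using (ℕ; zero; suc; _+_; _∸_; _<ᵇ_; _≡ᵇ_)
open import Data.Nat.Properties using (m+n∸m≡n; n∸n≡0; +-assoc; +-identityʳ)
open import Data.Bool using (true; false; if_then_else_; T)
open import Data.List using (List; []; _∷_; length; _++_)
open import Data.List.Properties using (length-++)
open import Data.Product using (Σ; _×_; _,_)
open import Data.Unit using (tt)
open import Relation.Nullary using (¬_; yes; no)
open import Relation.Nullary.Decidable using (T?)
open import Relation.Binary.Bundles using (Setoid)
open import Relation.Binary.Structures using (IsEquivalence)
open import Relation.Binary.PropositionalEquality
import Relation.Binary.Reasoning.Setoid

<ᵇ-irrefl : ∀ n → (n <ᵇ n) ≡ false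
<ᵇ-irrefl zero    = refl
<ᵇ-irrefl (suc n) = <ᵇ-irrefl n

≡ᵇ-refl : ∀ n → (n ≡ᵇ n) ≡ true
≡ᵇ-refl zero    = refl
≡ᵇ-refl (suc n) = ≡ᵇ-refl n

m<ᵇm+1+n≡true : ∀ m n → (m <ᵇ m + suc n) ≡ true
m<ᵇm+1+n≡true zero    n = refl
m<ᵇm+1+n≡true (suc m) n = m<ᵇm+1+n≡true m n

m+n<ᵇm≡false : ∀ m n → (m + n <ᵇ m) ≡ false
m+n<ᵇm≡false zero    n = refl
m+n<ᵇm≡false (suc m) n = m+n<ᵇm≡false m n

m+1+n≡ᵇm≡false : ∀ m n → (m + suc n ≡ᵇ m) ≡ false
m+1+n≡ᵇm≡false zero    n = refl
m+1+n≡ᵇm≡false (suc m) n = m+1+n≡ᵇm≡false m n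

+-cancelˡ-<ᵇ : ∀ a m n → (a + m <ᵇ a + n) ≡ (m <ᵇ n)
+-cancelˡ-<ᵇ zero    m n = refl
+-cancelˡ-<ᵇ (suc a) m n = +-cancelˡ-<ᵇ a m n

+-cancelˡ-≡ᵇ : ∀ a m n → (a + m ≡ᵇ a + n) ≡ (m ≡ᵇ n)
+-cancelˡ-≡ᵇ zero    m n = refl
+-cancelˡ-≡ᵇ (suc a) m n = +-cancelˡ-≡ᵇ a m n

-- Unlike Data.Nat.Base.compare, the gap is written m + suc k, the shape _+ₒ_ produces.
data Compare : ℕ → ℕ → Set where
  less    : ∀ m k → Compare m (m + suc k)
  equal   : ∀ m → Compare m m
  greater : ∀ m k → Compare (m + suc k) m

compare′ : ∀ m n → Compare m n
compare′ zero    zero    = equal 0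
compare′ zero    (suc n) = less 0 n
compare′ (suc m) zero    = greater 0 m
compare′ (suc m) (suc n) with compare′ m n
... | less    .m k = less (suc m) k
... | equal   .m   = equal (suc m)
... | greater .n k = greater (suc n) k

+ₒ-assoc : ∀ α β γ → ((α +ₒ β) +ₒ γ) ≡ (α +ₒ (β +ₒ γ))
+ₒ-assoc ⟨ a , b , c ⟩ ⟨ suc p , q , r ⟩ ⟨ suc x , y , z ⟩ rewrite +-assoc a (suc p) (suc x) = refl
+ₒ-assoc ⟨ a , b , c ⟩ ⟨ zero , suc q , r ⟩ ⟨ suc x , y , z ⟩ = refl
+ₒ-assoc ⟨ a , b , c ⟩ ⟨ zero , zero , r ⟩ ⟨ suc x , y , z ⟩ = refl
+ₒ-assoc ⟨ a , b , c ⟩ ⟨ suc p , q , r ⟩ ⟨ zero , suc y , z ⟩ = refl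
+ₒ-assoc ⟨ a , b , c ⟩ ⟨ zero , suc q , r ⟩ ⟨ zero , suc y , z ⟩
  rewrite +-assoc b (suc q) (suc y) = refl
+ₒ-assoc ⟨ a , b , c ⟩ ⟨ zero , zero , r ⟩ ⟨ zero , suc y , z ⟩ = refl
+ₒ-assoc ⟨ a , b , c ⟩ ⟨ suc p , q , r ⟩ ⟨ zero , zero , z ⟩ = refl
+ₒ-assoc ⟨ a , b , c ⟩ ⟨ zero , suc q , r ⟩ ⟨ zero , zero , z ⟩ = refl
+ₒ-assoc ⟨ a , b , c ⟩ ⟨ zero , zero , r ⟩ ⟨ zero , zero , z ⟩ rewrite +-assoc c r z = refl

+ₒ-identityˡ : ∀ α → (⟨ 0 , 0 , 0 ⟩ +ₒ α) ≡ α
+ₒ-identityˡ ⟨ suc a , b , c ⟩    = refl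
+ₒ-identityˡ ⟨ zero , suc b , c ⟩ = refl
+ₒ-identityˡ ⟨ zero , zero , c ⟩  = refl

m+ₒn<ᵒᵇm≡false : ∀ α δ → ((α +ₒ δ) <ᵒᵇ α) ≡ false
m+ₒn<ᵒᵇm≡false ⟨ a , b , c ⟩ ⟨ suc x , y , z ⟩
  rewrite m+n<ᵇm≡false a (suc x) | m+1+n≡ᵇm≡false a x = refl
m+ₒn<ᵒᵇm≡false ⟨ a , b , c ⟩ ⟨ zero , suc y , z ⟩
  rewrite <ᵇ-irrefl a | ≡ᵇ-refl a | m+n<ᵇm≡false b (suc y) | m+1+n≡ᵇm≡false b y = refl
m+ₒn<ᵒᵇm≡false ⟨ a , b , c ⟩ ⟨ zero , zero , z ⟩
  rewrite <ᵇ-irrefl a | ≡ᵇ-refl a | <ᵇ-irrefl b | ≡ᵇ-refl b | m+n<ᵇm≡false c z = refl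

m+ₒn∸ₒm≡n : ∀ α δ → ((α +ₒ δ) ∸ₒ α) ≡ δ
m+ₒn∸ₒm≡n ⟨ a , b , c ⟩ ⟨ suc x , y , z ⟩
  rewrite m<ᵇm+1+n≡true a x | m+n∸m≡n a (suc x) = refl
m+ₒn∸ₒm≡n ⟨ a , b , c ⟩ ⟨ zero , suc y , z ⟩
  rewrite <ᵇ-irrefl a | m<ᵇm+1+n≡true b y | m+n∸m≡n b (suc y) = refl
m+ₒn∸ₒm≡n ⟨ a , b , c ⟩ ⟨ zero , zero , z ⟩
  rewrite <ᵇ-irrefl a | <ᵇ-irrefl b | m+n∸m≡n c z = refl

m+ₒ[n∸ₒm]≡n : ∀ γ α → ¬ γ <ₒ α → (α +ₒ (γ ∸ₒ α)) ≡ γ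
m+ₒ[n∸ₒm]≡n ⟨ a' , b' , c' ⟩ ⟨ a , b , c ⟩ γ≮α with compare′ a a'
m+ₒ[n∸ₒm]≡n ⟨ .(a + suc k) , b' , c' ⟩ ⟨ a , b , c ⟩ γ≮α | less .a k
  rewrite m<ᵇm+1+n≡true a k | m+n∸m≡n a (suc k) = refl
m+ₒ[n∸ₒm]≡n ⟨ a' , b' , c' ⟩ ⟨ .(a' + suc k) , b , c ⟩ γ≮α | greater .a' k
  rewrite m<ᵇm+1+n≡true a' k with () ← γ≮α tt
m+ₒ[n∸ₒm]≡n ⟨ a , b' , c' ⟩ ⟨ .a , b , c ⟩ γ≮α | equal .a with compare′ b b'
m+ₒ[n∸ₒm]≡n ⟨ a , .(b + suc k) , c' ⟩ ⟨ .a , b , c ⟩ γ≮α | equal .a | less .b k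
  rewrite <ᵇ-irrefl a | m<ᵇm+1+n≡true b k | m+n∸m≡n b (suc k) = refl
m+ₒ[n∸ₒm]≡n ⟨ a , b' , c' ⟩ ⟨ .a , .(b' + suc k) , c ⟩ γ≮α | equal .a | greater .b' k
  rewrite <ᵇ-irrefl a | ≡ᵇ-refl a | m<ᵇm+1+n≡true b' k with () ← γ≮α tt
m+ₒ[n∸ₒm]≡n ⟨ a , b , c' ⟩ ⟨ .a , .b , c ⟩ γ≮α | equal .a | equal .b with compare′ c c'
m+ₒ[n∸ₒm]≡n ⟨ a , b , .(c + suc k) ⟩ ⟨ .a , .b , c ⟩ γ≮α | equal .a | equal .b | less .c k
  rewrite <ᵇ-irrefl a | <ᵇ-irrefl b | m+n∸m≡n c (suc k) = refl
m+ₒ[n∸ₒm]≡n ⟨ a , b , c ⟩ ⟨ .a , .b , .c ⟩ γ≮α | equal .a | equal .b | equal .c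
  rewrite <ᵇ-irrefl a | <ᵇ-irrefl b | n∸n≡0 c | +-identityʳ c = refl
m+ₒ[n∸ₒm]≡n ⟨ a , b , c' ⟩ ⟨ .a , .b , .(c' + suc k) ⟩ γ≮α | equal .a | equal .b | greater .c' k
  rewrite <ᵇ-irrefl a | ≡ᵇ-refl a | <ᵇ-irrefl b | ≡ᵇ-refl b | m<ᵇm+1+n≡true c' k with () ← γ≮α tt

+ₒ-cancelˡ-<ᵒᵇ : ∀ α δ β → ((α +ₒ δ) <ᵒᵇ (α +ₒ β)) ≡ (δ <ᵒᵇ β)
+ₒ-cancelˡ-<ᵒᵇ ⟨ a , b , c ⟩ ⟨ suc x , y , z ⟩ ⟨ suc p , q , r ⟩
  rewrite +-cancelˡ-<ᵇ a (suc x) (suc p) | +-cancelˡ-≡ᵇ a (suc x) (suc p) = refl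
+ₒ-cancelˡ-<ᵒᵇ ⟨ a , b , c ⟩ ⟨ suc x , y , z ⟩ ⟨ zero , suc q , r ⟩
  rewrite m+n<ᵇm≡false a (suc x) | m+1+n≡ᵇm≡false a x = refl
+ₒ-cancelˡ-<ᵒᵇ ⟨ a , b , c ⟩ ⟨ suc x , y , z ⟩ ⟨ zero , zero , r ⟩
  rewrite m+n<ᵇm≡false a (suc x) | m+1+n≡ᵇm≡false a x = refl
+ₒ-cancelˡ-<ᵒᵇ ⟨ a , b , c ⟩ ⟨ zero , suc y , z ⟩ ⟨ suc p , q , r ⟩
  rewrite m<ᵇm+1+n≡true a p = refl
+ₒ-cancelˡ-<ᵒᵇ ⟨ a , b , c ⟩ ⟨ zero , suc y , z ⟩ ⟨ zero , suc q , r ⟩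
  rewrite <ᵇ-irrefl a | ≡ᵇ-refl a
        | +-cancelˡ-<ᵇ b (suc y) (suc q) | +-cancelˡ-≡ᵇ b (suc y) (suc q) = refl
+ₒ-cancelˡ-<ᵒᵇ ⟨ a , b , c ⟩ ⟨ zero , suc y , z ⟩ ⟨ zero , zero , r ⟩
  rewrite <ᵇ-irrefl a | ≡ᵇ-refl a | m+n<ᵇm≡false b (suc y) | m+1+n≡ᵇm≡false b y = refl
+ₒ-cancelˡ-<ᵒᵇ ⟨ a , b , c ⟩ ⟨ zero , zero , z ⟩ ⟨ suc p , q , r ⟩
  rewrite m<ᵇm+1+n≡true a p = refl
+ₒ-cancelˡ-<ᵒᵇ ⟨ a , b , c ⟩ ⟨ zero , zero , z ⟩ ⟨ zero , suc q , r ⟩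
  rewrite <ᵇ-irrefl a | ≡ᵇ-refl a | m<ᵇm+1+n≡true b q = refl
+ₒ-cancelˡ-<ᵒᵇ ⟨ a , b , c ⟩ ⟨ zero , zero , z ⟩ ⟨ zero , zero , r ⟩
  rewrite <ᵇ-irrefl a | ≡ᵇ-refl a | <ᵇ-irrefl b | ≡ᵇ-refl b | +-cancelˡ-<ᵇ c z r = refl

data Split (α : Ord) : Ord → Set where
  below : ∀ {γ} → γ <ₒ α → Split α γ
  above : ∀ δ → Split α (α +ₒ δ)

split : ∀ α γ → Split α γ
split α γ with T? (γ <ᵒᵇ α)
... | yes γ<α = below γ<α
... | no  γ≮α = subst (Split α) (m+ₒ[n∸ₒm]≡n γ α γ≮α) (above (γ ∸ₒ α))

<ₒ-+ₒ-ind : ∀ (P : Ord → Set) α β → (∀ γ → γ <ₒ α → P γ) → (∀ δ → δ <ₒ β → P (α +ₒ δ)) →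
            ∀ γ → γ <ₒ (α +ₒ β) → P γ
<ₒ-+ₒ-ind P α β P<α P≥α γ γ<α+β with split α γ
... | below γ<α = P<α γ γ<α
... | above δ   = P≥α δ (subst T (+ₒ-cancelˡ-<ᵒᵇ α δ β) γ<α+β)

-- at (s ⌢ t) is definitionally splice (len s) (at s) (at t).
splice : {A : Set} → Ord → (Ord → A) → (Ord → A) → Ord → A
splice α f g γ = if γ <ᵒᵇ α then f γ else g (γ ∸ₒ α)

splice-below : ∀ {A : Set} α (f g : Ord → A) {γ} → γ <ₒ α → splice α f g γ ≡ f γ
splice-below α f g {γ} γ<α with γ <ᵒᵇ α
... | true = refl

splice-above : ∀ {A : Set} α (f g : Ord → A) δ → splice α f g (α +ₒ δ) ≡ g δ
splice-above α f g δ rewrite m+ₒn<ᵒᵇm≡false α δ | m+ₒn∸ₒm≡n α δ = refl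

≈-isEquivalence : IsEquivalence _≈_
≈-isEquivalence = record
  { refl  = refl , λ _ _ → refl
  ; sym   = λ { (s≡t , e) → sym s≡t , λ γ γ< → sym (e γ (subst (γ <ₒ_) (sym s≡t) γ<)) }
  ; trans = λ { (s≡t , e) (t≡u , e′) →
                trans s≡t t≡u , λ γ γ< → trans (e γ γ<) (e′ γ (subst (γ <ₒ_) s≡t γ<)) }
  }

≈-setoid : Setoid _ _
≈-setoid = record { isEquivalence = ≈-isEquivalence }

open Setoid ≈-setoid using () renaming (refl to ≈-refl; sym to ≈-sym; trans to ≈-trans)
module ≈-Reasoning = Relation.Binary.Reasoning.Setoid ≈-setoid

⌢-cong : ∀ {s s′ t t′} → s ≈ s′ → t ≈ t′ → (s ⌢ t) ≈ (s′ ⌢ t′)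
⌢-cong {s} {mkSeq _ f} {t} {mkSeq _ g} (refl , s≐) (refl , t≐) =
  refl , <ₒ-+ₒ-ind (λ γ → at (s ⌢ t) γ ≡ splice (len s) f g γ) (len s) (len t)
           (λ γ γ<α → trans (splice-below (len s) (at s) (at t) γ<α)
                      (trans (s≐ γ γ<α) (sym (splice-below (len s) f g γ<α))))
           (λ δ δ<β → trans (splice-above (len s) (at s) (at t) δ)
                      (trans (t≐ δ δ<β) (sym (splice-above (len s) f g δ))))

⌢-congˡ : ∀ s {t t′} → t ≈ t′ → (s ⌢ t) ≈ (s ⌢ t′)
⌢-congˡ s = ⌢-cong (≈-refl {s})

⌢-congʳ : ∀ t {s s′} → s ≈ s′ → (s ⌢ t) ≈ (s′ ⌢ t)
⌢-congʳ t s≈s′ = ⌢-cong s≈s′ (≈-refl {t})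

⌢-assoc : ∀ s t u → ((s ⌢ t) ⌢ u) ≈ (s ⌢ (t ⌢ u))
⌢-assoc s t u = +ₒ-assoc α β (len u) , entries
  where
  open ≡-Reasoning
  α = len s
  β = len t
  entries : ∀ γ → γ <ₒ len ((s ⌢ t) ⌢ u) → at ((s ⌢ t) ⌢ u) γ ≡ at (s ⌢ (t ⌢ u)) γ
  entries γ _ with split (α +ₒ β) γ
  entries γ _ | below γ<α+β with split α γ
  ... | below γ<α = begin
    at ((s ⌢ t) ⌢ u) γ ≡⟨ splice-below (α +ₒ β) (at (s ⌢ t)) (at u) γ<α+β ⟩
    at (s ⌢ t) γ       ≡⟨ splice-below α (at s) (at t) γ<α ⟩
    at s γ             ≡⟨ splice-below α (at s) (at (t ⌢ u)) γ<α ⟨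
    at (s ⌢ (t ⌢ u)) γ ∎
  ... | above δ = begin
    at ((s ⌢ t) ⌢ u) (α +ₒ δ) ≡⟨ splice-below (α +ₒ β) (at (s ⌢ t)) (at u) γ<α+β ⟩
    at (s ⌢ t) (α +ₒ δ)       ≡⟨ splice-above α (at s) (at t) δ ⟩
    at t δ                    ≡⟨ splice-below β (at t) (at u) (subst T (+ₒ-cancelˡ-<ᵒᵇ α δ β) γ<α+β) ⟨
    at (t ⌢ u) δ              ≡⟨ splice-above α (at s) (at (t ⌢ u)) δ ⟨
    at (s ⌢ (t ⌢ u)) (α +ₒ δ) ∎
  entries γ _ | above ν = begin
    at ((s ⌢ t) ⌢ u) ((α +ₒ β) +ₒ ν) ≡⟨ splice-above (α +ₒ β) (at (s ⌢ t)) (at u) ν ⟩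
    at u ν                           ≡⟨ splice-above β (at t) (at u) ν ⟨
    at (t ⌢ u) (β +ₒ ν)              ≡⟨ splice-above α (at s) (at (t ⌢ u)) (β +ₒ ν) ⟨
    at (s ⌢ (t ⌢ u)) (α +ₒ (β +ₒ ν)) ≡⟨ cong (at (s ⌢ (t ⌢ u))) (+ₒ-assoc α β ν) ⟨
    at (s ⌢ (t ⌢ u)) ((α +ₒ β) +ₒ ν) ∎

⌢-identityˡ : ∀ e s → len e ≡ ⟨ 0 , 0 , 0 ⟩ → (e ⌢ s) ≈ s
⌢-identityˡ (mkSeq _ f) s refl = +ₒ-identityˡ (len s) , entries
  where
  entries : ∀ γ → γ <ₒ len (mkSeq ⟨ 0 , 0 , 0 ⟩ f ⌢ s) → at (mkSeq ⟨ 0 , 0 , 0 ⟩ f ⌢ s) γ ≡ at s γ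
  entries ⟨ suc a , b , c ⟩    _ = refl
  entries ⟨ zero , suc b , c ⟩ _ = refl
  entries ⟨ zero , zero , c ⟩  _ = refl

nth-++ : ∀ (v w : List ℕ) i →
         nth (v ++ w) i ≡ (if i <ᵇ length v then nth v i else nth w (i ∸ length v))
nth-++ []      w i       = refl
nth-++ (x ∷ v) w zero    = refl
nth-++ (x ∷ v) w (suc i) = nth-++ v w i

fin-++ : ∀ v w → (fin v ⌢ fin w) ≈ fin (v ++ w)
fin-++ v w = cong (λ n → ⟨ 0 , 0 , n ⟩) (sym (length-++ v)) , entries
  where
  entries : ∀ γ → γ <ₒ len (fin v ⌢ fin w) → at (fin v ⌢ fin w) γ ≡ at (fin (v ++ w)) γ
  entries ⟨ zero , zero , i ⟩ _ = sym (nth-++ v w i)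

In𝒩-fin-⌢ : ∀ w s → In𝒩 s → In𝒩 (fin w ⌢ s)
In𝒩-fin-⌢ w s (v , k , s≈vNₖ) = w ++ v , k , (begin
  fin w ⌢ s                  ≈⟨ ⌢-congˡ (fin w) s≈vNₖ ⟩
  fin w ⌢ (fin v ⌢ Nseq k)   ≈⟨ ⌢-assoc (fin w) (fin v) (Nseq k) ⟨
  (fin w ⌢ fin v) ⌢ Nseq k   ≈⟨ ⌢-congʳ (Nseq k) (fin-++ w v) ⟩
  fin (w ++ v) ⌢ Nseq k      ∎)
  where open ≈-Reasoning

In𝔏-resp-≈ : ∀ {s t} → s ≈ t → In𝔏 t → In𝔏 s
In𝔏-resp-≈ s≈t (m , k , 𝔩 , w , 𝔩∈𝒩 , t≈) = m , k , 𝔩 , w , 𝔩∈𝒩 , ≈-trans s≈t t≈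

In𝔏-fin : ∀ w → In𝔏 (fin w)
In𝔏-fin w = 0 , 0 , (λ _ → εₛ) , w , (λ { ⟨ zero , zero , _ ⟩ () }) ,
            refl , λ { ⟨ zero , zero , _ ⟩ _ → refl }

εₛ≈fin[] : εₛ ≈ fin []
εₛ≈fin[] = refl , λ { ⟨ zero , zero , _ ⟩ () }

⟦n⟧≈fin[n] : ∀ n → ⟦ n ⟧ ≈ fin (n ∷ [])
⟦n⟧≈fin[n] n = refl , λ { ⟨ zero , zero , zero ⟩ _ → refl }

All𝒩 : Ord → (Ord → Seq) → Set
All𝒩 β 𝔩 = ∀ δ → δ <ₒ β → In𝒩 (𝔩 δ)

All𝒩-splice : ∀ α β {𝔩₁ 𝔩₂} → All𝒩 α 𝔩₁ → All𝒩 β 𝔩₂ → All𝒩 (α +ₒ β) (splice α 𝔩₁ 𝔩₂)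
All𝒩-splice α β {𝔩₁} {𝔩₂} 𝔩₁∈ 𝔩₂∈ = <ₒ-+ₒ-ind (λ γ → In𝒩 (splice α 𝔩₁ 𝔩₂ γ)) α β
  (λ γ γ<α → subst In𝒩 (sym (splice-below α 𝔩₁ 𝔩₂ γ<α)) (𝔩₁∈ γ γ<α))
  (λ δ δ<β → subst In𝒩 (sym (splice-above α 𝔩₁ 𝔩₂ δ)) (𝔩₂∈ δ δ<β))

prepend : List ℕ → (Ord → Seq) → Ord → Seq
prepend w 𝔩 ⟨ zero , zero , zero ⟩ = fin w ⌢ 𝔩 ⟨ 0 , 0 , 0 ⟩
prepend w 𝔩 δ                      = 𝔩 δ

All𝒩-prepend : ∀ w β {𝔩} → ⟨ 0 , 0 , 0 ⟩ <ₒ β → All𝒩 β 𝔩 → All𝒩 β (prepend w 𝔩)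
All𝒩-prepend w β 0<β 𝔩∈ ⟨ zero , zero , zero ⟩  _   = In𝒩-fin-⌢ w _ (𝔩∈ _ 0<β)
All𝒩-prepend w β 0<β 𝔩∈ ⟨ zero , zero , suc c ⟩ δ<β = 𝔩∈ _ δ<β
All𝒩-prepend w β 0<β 𝔩∈ ⟨ zero , suc b , c ⟩    δ<β = 𝔩∈ _ δ<β
All𝒩-prepend w β 0<β 𝔩∈ ⟨ suc a , b , c ⟩       δ<β = 𝔩∈ _ δ<β

-- |w| + ω·β = ω·β as soon as β > 0.
fin-⌢-floorω : ∀ w m k 𝔩 → ⟨ 0 , 0 , 0 ⟩ <ₒ ⟨ 0 , m , k ⟩ →
               (fin w ⌢ floorω m k 𝔩) ≈ floorω m k (prepend w 𝔩)
fin-⌢-floorω w m k 𝔩 0<β = absorbed m k 0<β , λ γ _ → entries γ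
  where
  absorbed : ∀ m k → ⟨ 0 , 0 , 0 ⟩ <ₒ ⟨ 0 , m , k ⟩ →
             (⟨ 0 , 0 , length w ⟩ +ₒ ⟨ m , k , 0 ⟩) ≡ ⟨ m , k , 0 ⟩
  absorbed (suc m) k       _ = refl
  absorbed zero    (suc k) _ = refl
  entries : ∀ γ → at (fin w ⌢ floorω m k 𝔩) γ ≡ at (floorω m k (prepend w 𝔩)) γ
  entries ⟨ suc a , b , c ⟩    = refl
  entries ⟨ zero , suc b , c ⟩ = refl
  entries ⟨ zero , zero , c ⟩  = refl

+ₒ-below-ω² : ∀ m₁ k₁ m₂ k₂ →
              Σ ℕ λ m → Σ ℕ λ k → (⟨ 0 , m₁ , k₁ ⟩ +ₒ ⟨ 0 , m₂ , k₂ ⟩) ≡ ⟨ 0 , m , k ⟩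
+ₒ-below-ω² m₁ k₁ (suc m₂) k₂       = m₁ + suc m₂ , k₂ , refl
+ₒ-below-ω² m₁ k₁ zero     (suc k₂) = m₁ , k₁ + suc k₂ , refl
+ₒ-below-ω² m₁ k₁ zero     zero     = m₁ , k₁ + 0 , refl

-- ω·β₁ + ω·β₂ = ω·(β₁ + β₂)
floorω-⌢ : ∀ m₁ k₁ 𝔩₁ m₂ k₂ 𝔩₂ {m k} → (⟨ 0 , m₁ , k₁ ⟩ +ₒ ⟨ 0 , m₂ , k₂ ⟩) ≡ ⟨ 0 , m , k ⟩ →
           (floorω m₁ k₁ 𝔩₁ ⌢ floorω m₂ k₂ 𝔩₂) ≈ floorω m k (splice ⟨ 0 , m₁ , k₁ ⟩ 𝔩₁ 𝔩₂)
floorω-⌢ m₁ k₁ 𝔩₁ m₂ k₂ 𝔩₂ {m} {k} β≡ = lengths m₂ k₂ β≡ , λ γ _ → entries γ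
  where
  lengths : ∀ m₂ k₂ {m k} → (⟨ 0 , m₁ , k₁ ⟩ +ₒ ⟨ 0 , m₂ , k₂ ⟩) ≡ ⟨ 0 , m , k ⟩ →
            (⟨ m₁ , k₁ , 0 ⟩ +ₒ ⟨ m₂ , k₂ , 0 ⟩) ≡ ⟨ m , k , 0 ⟩
  lengths (suc m₂) k₂       refl = refl
  lengths zero     (suc k₂) refl = refl
  lengths zero     zero     refl = cong (λ k → ⟨ m₁ , k , 0 ⟩) (sym (+-identityʳ k₁))
  entries : ∀ γ → at (floorω m₁ k₁ 𝔩₁ ⌢ floorω m₂ k₂ 𝔩₂) γ
                  ≡ at (floorω m k (splice ⟨ 0 , m₁ , k₁ ⟩ 𝔩₁ 𝔩₂)) γ
  entries ⟨ a , b , c ⟩ with compare′ m₁ a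
  entries ⟨ .(m₁ + suc j) , b , c ⟩ | less .m₁ j
    rewrite m+n<ᵇm≡false m₁ (suc j) | m+1+n≡ᵇm≡false m₁ j | m<ᵇm+1+n≡true m₁ j = refl
  entries ⟨ a , b , c ⟩ | greater .a j
    rewrite m<ᵇm+1+n≡true a j = refl
  entries ⟨ .m₁ , b , c ⟩ | equal .m₁ with compare′ k₁ b
  entries ⟨ .m₁ , .(k₁ + suc j) , c ⟩ | equal .m₁ | less .k₁ j
    rewrite <ᵇ-irrefl m₁ | ≡ᵇ-refl m₁
          | m+n<ᵇm≡false k₁ (suc j) | m+1+n≡ᵇm≡false k₁ j | m<ᵇm+1+n≡true k₁ j = refl
  entries ⟨ .m₁ , b , c ⟩ | equal .m₁ | greater .b j
    rewrite <ᵇ-irrefl m₁ | ≡ᵇ-refl m₁ | m<ᵇm+1+n≡true b j = refl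
  entries ⟨ .m₁ , .k₁ , c ⟩ | equal .m₁ | equal .k₁
    rewrite <ᵇ-irrefl m₁ | ≡ᵇ-refl m₁ | <ᵇ-irrefl k₁ | ≡ᵇ-refl k₁ | n∸n≡0 k₁ = refl

⌢-floorω-empty : ∀ s w 𝔩 v → ((s ⌢ fin w) ⌢ (floorω 0 0 𝔩 ⌢ fin v)) ≈ (s ⌢ fin (w ++ v))
⌢-floorω-empty s w 𝔩 v = begin
  (s ⌢ fin w) ⌢ (floorω 0 0 𝔩 ⌢ fin v)  ≈⟨ ⌢-congˡ (s ⌢ fin w) (⌢-identityˡ (floorω 0 0 𝔩) (fin v) refl) ⟩
  (s ⌢ fin w) ⌢ fin v                   ≈⟨ ⌢-assoc s (fin w) (fin v) ⟩
  s ⌢ (fin w ⌢ fin v)                   ≈⟨ ⌢-congˡ s (fin-++ w v) ⟩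
  s ⌢ fin (w ++ v)                      ∎
  where open ≈-Reasoning

⌢-floorω-positive : ∀ s w m k 𝔩 v → ⟨ 0 , 0 , 0 ⟩ <ₒ ⟨ 0 , m , k ⟩ →
                    ((s ⌢ fin w) ⌢ (floorω m k 𝔩 ⌢ fin v)) ≈ ((s ⌢ floorω m k (prepend w 𝔩)) ⌢ fin v)
⌢-floorω-positive s w m k 𝔩 v 0<β = begin
  (s ⌢ fin w) ⌢ (F ⌢ fin v)               ≈⟨ ⌢-assoc s (fin w) (F ⌢ fin v) ⟩
  s ⌢ (fin w ⌢ (F ⌢ fin v))               ≈⟨ ⌢-congˡ s (⌢-assoc (fin w) F (fin v)) ⟨
  s ⌢ ((fin w ⌢ F) ⌢ fin v)               ≈⟨ ⌢-congˡ s (⌢-congʳ (fin v) (fin-⌢-floorω w m k 𝔩 0<β)) ⟩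
  s ⌢ (floorω m k (prepend w 𝔩) ⌢ fin v)  ≈⟨ ⌢-assoc s (floorω m k (prepend w 𝔩)) (fin v) ⟨
  (s ⌢ floorω m k (prepend w 𝔩)) ⌢ fin v  ∎
  where
  open ≈-Reasoning
  F = floorω m k 𝔩

In𝔏-⌢ : ∀ l₁ l₂ → In𝔏 l₁ → In𝔏 l₂ → In𝔏 (l₁ ⌢ l₂)
In𝔏-⌢ l₁ l₂ (m₁ , k₁ , 𝔩₁ , w₁ , 𝔩₁∈ , l₁≈) (m₂ , k₂ , 𝔩₂ , w₂ , 𝔩₂∈ , l₂≈) =
  In𝔏-resp-≈ (⌢-cong l₁≈ l₂≈) (normalForm m₂ k₂ 𝔩₂∈)
  where
  β₁ = ⟨ 0 , m₁ , k₁ ⟩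
  F₁ = floorω m₁ k₁ 𝔩₁
  positive : ∀ {m₂ k₂} → ⟨ 0 , 0 , 0 ⟩ <ₒ ⟨ 0 , m₂ , k₂ ⟩ → All𝒩 ⟨ 0 , m₂ , k₂ ⟩ 𝔩₂ →
             In𝔏 ((F₁ ⌢ fin w₁) ⌢ (floorω m₂ k₂ 𝔩₂ ⌢ fin w₂))
  positive {m₂} {k₂} 0<β₂ 𝔩₂∈ with +ₒ-below-ω² m₁ k₁ m₂ k₂
  ... | m , k , β≡ = m , k , splice β₁ 𝔩₁ (prepend w₁ 𝔩₂) , w₂ ,
    subst (λ β → All𝒩 β _) β≡ (All𝒩-splice β₁ β₂ 𝔩₁∈ (All𝒩-prepend w₁ β₂ 0<β₂ 𝔩₂∈)) ,
    ≈-trans (⌢-floorω-positive F₁ w₁ m₂ k₂ 𝔩₂ w₂ 0<β₂)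
            (⌢-congʳ (fin w₂) (floorω-⌢ m₁ k₁ 𝔩₁ m₂ k₂ (prepend w₁ 𝔩₂) β≡))
    where β₂ = ⟨ 0 , m₂ , k₂ ⟩
  normalForm : ∀ m₂ k₂ → All𝒩 ⟨ 0 , m₂ , k₂ ⟩ 𝔩₂ → In𝔏 ((F₁ ⌢ fin w₁) ⌢ (floorω m₂ k₂ 𝔩₂ ⌢ fin w₂))
  normalForm zero    zero    _   = m₁ , k₁ , 𝔩₁ , w₁ ++ w₂ , 𝔩₁∈ , ⌢-floorω-empty F₁ w₁ 𝔩₂ w₂
  normalForm zero    (suc _) 𝔩₂∈ = positive tt 𝔩₂∈
  normalForm (suc _) _       𝔩₂∈ = positive tt 𝔩₂∈

lemma4p9 : In𝔏 εₛ
             × (∀ (n : ℕ) (l : Seq) → In𝔏 l → In𝔏 (⟦ n ⟧ ⌢ l))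
             × (∀ (l₁ l₂ : Seq) → In𝔏 l₁ → In𝔏 l₂ → In𝔏 (l₁ ⌢ l₂))
lemma4p9 = In𝔏-resp-≈ εₛ≈fin[] (In𝔏-fin [])
         , (λ n l → In𝔏-⌢ ⟦ n ⟧ l (In𝔏-resp-≈ (⟦n⟧≈fin[n] n) (In𝔏-fin (n ∷ []))))
         , In𝔏-⌢
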